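{- Let $\lambda=(\lambda_1,\lambda_2)$ be a composition of $n$ with two positive parts. Then: (1) $\{v_0,v_1,\dots,v_{\lambda_2}\}=\{v\in{}^\lambda S_n: v_0\le v\}$; (2) for $0\le k,j\le\lambda_2$, $v_k\le v_j$ in Bruhat order if and only if $k\le j$.
   Context: ${}^\lambda S_n$ is the set of $v\in S_n$ with $v^{ -1}(1)<\dots<v^{ -1}(\lambda_1)$ and $v^{ -1}(\lambda_1+1)<\dots<v^{ -1}(n)$. For $0\le k\le\lambda_2$, $v_k\in S_n$ is the permutation with one-line notation $[\lambda_1+1,\lambda_1+2,\dots,\lambda_1+k,\,1,\,\lambda_1+k+1,\dots,n,\,2,3,\dots,\lambda_1]$ (entry $1$ in position $k+1$, last $\lambda_1-1$ entries $2,\dots,\lambda_1$). Bruhat order is $\le$. -}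

module Defs where

open import Data.Nat using (ℕ; zero; suc; _+_; _∸_; _≤_; _<_; _<?_)
open import Data.Fin using (Fin; toℕ; _≟_)
open import Data.List using (List; length; filter; cartesianProduct; allFin)
open import Data.Product using (Σ; ∃; _×_; _,_)
open import Relation.Nullary.Decidable using (_×-dec_; does; yes; no)
import Data.Nat
open import Data.Bool using (if_then_else_)
open import Relation.Binary.PropositionalEquality using (_≡_)

-- A permutation of {1,…,n} is represented by its one-line notation:
-- a function w : Fin n → ℕ, where w p is the entry in (0-based) position p.
OneLine : ℕ → Set
OneLine n = Fin n → ℕ

_≗ₒ_ : ∀ {n} → OneLine n → OneLine n → Set
u ≗ₒ w = ∀ p → u p ≡ w p

InS : (n : ℕ) → OneLine n → Set
InS n w = (∀ p → 1 ≤ w p × w p ≤ n) × (∀ p q → w p ≡ w q → p ≡ q)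

-- Coxeter length = number of inversions
inversions : ∀ {n} → OneLine n → ℕ
inversions {n} w =
  length (filter (λ { (i , j) → (toℕ i <? toℕ j) ×-dec (w j <? w i) })
                 (cartesianProduct (allFin n) (allFin n)))

-- w · t_{ij}: swap the entries in positions i and j
swapPos : ∀ {n} → Fin n → Fin n → OneLine n → OneLine n
swapPos i j w p =
  if does (p ≟ i) then w j else (if does (p ≟ j) then w i else w p)

BruhatStep : ∀ {n} → OneLine n → OneLine n → Set
BruhatStep {n} u w =
  Σ (Fin n) λ i → Σ (Fin n) λ j → (w ≗ₒ swapPos i j u) × (inversions u < inversions w)

data _≤B_ {n : ℕ} : OneLine n → OneLine n → Set where
  ≤B-refl : ∀ {u w} → u ≗ₒ w → u ≤B w
  ≤B-step : ∀ {u w' w} → BruhatStep u w' → w' ≤B w → u ≤B w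

-- ^λ S_n for λ = (a , b), n = a + b:
-- v⁻¹(1) < … < v⁻¹(a)  and  v⁻¹(a+1) < … < v⁻¹(n)
InLeftParabolic : (a b : ℕ) → OneLine (a + b) → Set
InLeftParabolic a b v =
  (∀ p q → v p < v q → v q ≤ a → toℕ p < toℕ q) ×
  (∀ p q → a < v p → v p < v q → toℕ p < toℕ q)

-- v_k = [a+1, …, a+k, 1, a+k+1, …, n, 2, 3, …, a]   (λ = (a , b), n = a + b)
-- value at 0-based position p
vk : (a b k : ℕ) → OneLine (a + b)
vk a b k p with toℕ p <? k
... | yes _ = a + 1 + toℕ p
... | no _ with toℕ p Data.Nat.≟ k
...   | yes _ = 1
...   | no _ with toℕ p <? suc b
...     | yes _ = a + toℕ p
...     | no _ = toℕ p ∸ b + 1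

-- v_{k+1} arises from v_k by exchanging its entries 1 and λ₁+k+1 in positions k+1 and
-- k+2, which creates an inversion; hence v_0 < v_1 < ⋯ < v_{λ₂} is a Bruhat chain along
-- which the number of inversions strictly increases, and since Bruhat order refines the
-- length order, v_k ≤ v_j forces k ≤ j.  Going up in Bruhat order only swaps pairs of
-- positions i < j with u(i) < u(j), so it preserves the property of v_0 that the last
-- λ₁ − 1 positions carry small values (≤ λ₁).  In a permutation of ^λS_n with this
-- property the small values increase from left to right, so exactly one of them, namely
-- 1, sits among the first λ₂ + 1 positions, say at position k + 1, and 2, …, λ₁ fill the
-- tail; the large values increase as well and fill the remaining positions: this is v_k.

module Submission where

open import Defs
open import Level using (0ℓ)
open import Data.Bool using (Bool; true; false; _∧_; _∨_; if_then_else_)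
open import Data.Bool.Properties using (∧-zeroʳ)
open import Data.Empty using (⊥-elim)
open import Data.Fin using (Fin; toℕ; fromℕ<; _≟_)
open import Data.Fin.Properties using (toℕ<n; toℕ-fromℕ<; fromℕ<-toℕ; toℕ-injective; any?)
open import Data.List using (List; []; _∷_; length; filter; map; cartesianProduct; allFin)
open import Data.List.Membership.Propositional using (_∈_)
open import Data.List.Membership.Propositional.Properties
  using (∈-map⁺; ∈-cartesianProduct⁺; ∈-allFin)
open import Data.List.Membership.Propositional.Properties.WithK using (unique∧set⇒bag)
open import Data.List.Relation.Binary.BagAndSetEquality using (∼bag⇒↭)
open import Data.List.Relation.Binary.Permutation.Propositional using (_↭_)
open import Data.List.Relation.Binary.Permutation.Propositional.Properties
  using (↭-length; filter-↭)
open import Data.List.Relation.Binary.Sublist.Propositional using (⊆-refl)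
open import Data.List.Relation.Binary.Sublist.Propositional.Properties
  using (filter⁺; length-mono-≤)
open import Data.List.Relation.Unary.Any using (here; there)
open import Data.List.Relation.Unary.Unique.Propositional using (Unique)
import Data.List.Relation.Unary.Unique.Propositional.Properties as UniqueProperties
open import Data.Nat using (ℕ; zero; suc; _+_; _∸_; _≤_; _<_; z≤n; s≤s; s≤s⁻¹; _<?_; _≤?_)
import Data.Nat as ℕ
open import Data.Nat.Properties hiding (_≟_)
open import Data.Product using (Σ; _×_; _,_; proj₁; proj₂)
open import Function using (_∘′_)
open import Function.Bundles using (_⇔_; mk⇔; Equivalence)
open import Relation.Binary using (tri<; tri≈; tri>)
open import Relation.Binary.PropositionalEquality
open import Relation.Nullary using (¬_; yes; no; does)
open import Relation.Nullary.Decidable using (_×-dec_; dec-true; dec-false)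
open import Relation.Unary using (Pred; Decidable; _⊆_)

module _ {A : Set} {P Q : Pred A 0ℓ} (P? : Decidable P) (Q? : Decidable Q) (P⊆Q : P ⊆ Q) where

  length-filter-mono : ∀ xs → length (filter P? xs) ≤ length (filter Q? xs)
  length-filter-mono xs = length-mono-≤ (filter⁺ P? Q? (λ { refl → P⊆Q }) (⊆-refl {x = xs}))

  length-filter-strictMono : ∀ {x xs} → x ∈ xs → Q x → ¬ P x →
                             length (filter P? xs) < length (filter Q? xs)
  length-filter-strictMono {xs = y ∷ ys} (here refl) qy ¬py with P? y | Q? y
  ... | yes py | _      = ⊥-elim (¬py py)
  ... | no _   | yes _  = s≤s (length-filter-mono ys)
  ... | no _   | no ¬qy = ⊥-elim (¬qy qy)
  length-filter-strictMono {xs = y ∷ ys} (there x∈ys) qx ¬px with P? y | Q? y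
  ... | yes _  | yes _  = s≤s (length-filter-strictMono x∈ys qx ¬px)
  ... | yes py | no ¬qy = ⊥-elim (¬qy (P⊆Q py))
  ... | no _   | yes _  = m≤n⇒m≤1+n (length-filter-strictMono x∈ys qx ¬px)
  ... | no _   | no _   = length-filter-strictMono x∈ys qx ¬px

length-filter-map : ∀ {A B : Set} {Q : Pred B 0ℓ} (Q? : Decidable Q) (f : A → B) xs →
                    length (filter Q? (map f xs)) ≡ length (filter (λ x → Q? (f x)) xs)
length-filter-map Q? f [] = refl
length-filter-map Q? f (x ∷ xs) with Q? (f x)
... | yes _ = cong suc (length-filter-map Q? f xs)
... | no _  = length-filter-map Q? f xs

allPairs : ∀ n → List (Fin n × Fin n)
allPairs n = cartesianProduct (allFin n) (allFin n)

∈-allPairs : ∀ {n} (x : Fin n × Fin n) → x ∈ allPairs n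
∈-allPairs (p , q) = ∈-cartesianProduct⁺ (∈-allFin p) (∈-allFin q)

module _ {n : ℕ} (τ : Fin n × Fin n → Fin n × Fin n) (τ-involutive : ∀ x → τ (τ x) ≡ x) where

  map-involution-↭ : map τ (allPairs n) ↭ allPairs n
  map-involution-↭ = ∼bag⇒↭ (unique∧set⇒bag
      (UniqueProperties.map⁺ τ-injective allPairs-unique) allPairs-unique
      (λ {x} → mk⇔ (λ _ → ∈-allPairs x)
           (λ _ → subst (_∈ map τ (allPairs n)) (τ-involutive x) (∈-map⁺ τ (∈-allPairs (τ x))))))
    where
      allPairs-unique : Unique (allPairs n)
      allPairs-unique =
        UniqueProperties.cartesianProduct⁺ (UniqueProperties.allFin⁺ n) (UniqueProperties.allFin⁺ n)
      τ-injective : ∀ {x y} → τ x ≡ τ y → x ≡ y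
      τ-injective {x} {y} e = trans (sym (τ-involutive x)) (trans (cong τ e) (τ-involutive y))

  length-filter-involution : ∀ {Q : Pred (Fin n × Fin n) 0ℓ} (Q? : Decidable Q) →
    length (filter (λ x → Q? (τ x)) (allPairs n)) ≡ length (filter Q? (allPairs n))
  length-filter-involution Q? =
    trans (sym (length-filter-map Q? τ (allPairs n))) (↭-length (filter-↭ Q? map-involution-↭))

module _ (f : ℕ → ℕ) {N : ℕ} (step : ∀ t → suc t ≤ N → f t < f (suc t)) where

  stepwise-+-≤ : ∀ t d → t + d ≤ N → f t + d ≤ f (t + d)
  stepwise-+-≤ t zero _ = ≤-reflexive (trans (+-identityʳ (f t)) (cong f (sym (+-identityʳ t))))
  stepwise-+-≤ t (suc d) t+[1+d]≤N = begin
    f t + suc d      ≡⟨ +-suc (f t) d ⟩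
    suc (f t + d)    ≤⟨ s≤s (stepwise-+-≤ t d (≤-trans (+-monoʳ-≤ t (n≤1+n d)) t+[1+d]≤N)) ⟩
    suc (f (t + d))  ≤⟨ step (t + d) (subst (_≤ N) (+-suc t d) t+[1+d]≤N) ⟩
    f (suc (t + d))  ≡⟨ cong f (sym (+-suc t d)) ⟩
    f (t + suc d)    ∎
    where open ≤-Reasoning

  stepwise-strictMono : ∀ {s t} → s < t → t ≤ N → f s < f t
  stepwise-strictMono {s} {t} s<t t≤N = begin-strict
    f s            <⟨ m<m+n (f s) (s≤s z≤n) ⟩
    f s + suc d    ≤⟨ stepwise-+-≤ s (suc d) (subst (_≤ N) (sym s+[1+d]≡t) t≤N) ⟩
    f (s + suc d)  ≡⟨ cong f s+[1+d]≡t ⟩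
    f t            ∎
    where
      open ≤-Reasoning
      d : ℕ
      d = t ∸ suc s
      s+[1+d]≡t : s + suc d ≡ t
      s+[1+d]≡t = trans (+-suc s d) (m+[n∸m]≡n s<t)

  stepwise-squeeze : ∀ {lo} → lo ≤ f 0 → f N ≤ lo + N → ∀ t → t ≤ N → f t ≡ lo + t
  stepwise-squeeze {lo} lo≤f0 fN≤lo+N t t≤N = ≤-antisym upper lower
    where
      open ≤-Reasoning
      lower : lo + t ≤ f t
      lower = ≤-trans (+-monoˡ-≤ t lo≤f0) (stepwise-+-≤ 0 t t≤N)
      t+[N∸t]≡N : t + (N ∸ t) ≡ N
      t+[N∸t]≡N = m+[n∸m]≡n t≤N
      upper : f t ≤ lo + t
      upper = +-cancelʳ-≤ (N ∸ t) (f t) (lo + t) (begin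
        f t + (N ∸ t)    ≤⟨ stepwise-+-≤ t (N ∸ t) (≤-reflexive t+[N∸t]≡N) ⟩
        f (t + (N ∸ t))  ≡⟨ cong f t+[N∸t]≡N ⟩
        f N              ≤⟨ fN≤lo+N ⟩
        lo + N           ≡⟨ cong (lo +_) (sym t+[N∸t]≡N) ⟩
        lo + (t + (N ∸ t)) ≡⟨ sym (+-assoc lo t (N ∸ t)) ⟩
        lo + t + (N ∸ t) ∎)

IsInversion : ∀ {n} → OneLine n → Pred (Fin n × Fin n) 0ℓ
IsInversion u (p , q) = toℕ p < toℕ q × u q < u p

inversion? : ∀ {n} (u : OneLine n) → Decidable (IsInversion u)
inversion? u (p , q) = (toℕ p <? toℕ q) ×-dec (u q <? u p)

inversions-resp-≗ₒ : ∀ {n} {u w : OneLine n} → u ≗ₒ w → inversions u ≡ inversions w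
inversions-resp-≗ₒ {n} {u} {w} u≗w = ≤-antisym
  (length-filter-mono (inversion? u) (inversion? w) (transport u≗w) (allPairs n))
  (length-filter-mono (inversion? w) (inversion? u) (transport (λ p → sym (u≗w p))) (allPairs n))
  where
    transport : ∀ {u w : OneLine n} → u ≗ₒ w → IsInversion u ⊆ IsInversion w
    transport u≗w {p , q} (p<q , uq<up) = p<q , subst₂ _<_ (u≗w q) (u≗w p) uq<up

≤B⇒inversions-≤ : ∀ {n} {u w : OneLine n} → u ≤B w → inversions u ≤ inversions w
≤B⇒inversions-≤ (≤B-refl u≗w) = ≤-reflexive (inversions-resp-≗ₒ u≗w)
≤B⇒inversions-≤ (≤B-step (_ , _ , _ , ℓu<ℓw′) w′≤w) = ≤-trans (<⇒≤ ℓu<ℓw′) (≤B⇒inversions-≤ w′≤w)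

-- The involution τ of position pairs fixes the pairs inside {i, j} and those joining
-- {i, j} to a position strictly between i and j, and relabels all others by the
-- transposition σ = (i j).  It maps inversions of swapPos i j u to inversions of u,
-- and misses the inversion (i, j) of u.
module _ {n : ℕ} (u : OneLine n) {i j : Fin n} (i<j : toℕ i < toℕ j) (uj<ui : u j < u i) where

  private
    i≢j : ¬ i ≡ j
    i≢j i≡j = <-irrefl (cong toℕ i≡j) i<j

    σ : Fin n → Fin n
    σ p = if does (p ≟ i) then j else (if does (p ≟ j) then i else p)

    swapPos≡u∘σ : ∀ p → swapPos i j u p ≡ u (σ p)
    swapPos≡u∘σ p with does (p ≟ i)
    ... | true = refl
    ... | false with does (p ≟ j)
    ...   | true  = refl
    ...   | false = refl

    data Place (p : Fin n) : Set where
      at-i : p ≡ i → Place p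
      at-j : p ≡ j → Place p
      off  : ¬ p ≡ i → ¬ p ≡ j → Place p

    place : ∀ p → Place p
    place p with p ≟ i | p ≟ j
    ... | yes p≡i | _       = at-i p≡i
    ... | no _    | yes p≡j = at-j p≡j
    ... | no p≢i  | no p≢j  = off p≢i p≢j

    σ-i : σ i ≡ j
    σ-i = cong (if_then j else (if does (i ≟ j) then i else i)) (dec-true (i ≟ i) refl)

    σ-j : σ j ≡ i
    σ-j = cong₂ (if_then j else_) (dec-false (j ≟ i) (i≢j ∘′ sym))
            (cong (if_then i else j) (dec-true (j ≟ j) refl))

    σ-off : ∀ {p} → ¬ p ≡ i → ¬ p ≡ j → σ p ≡ p
    σ-off {p} p≢i p≢j = cong₂ (if_then j else_) (dec-false (p ≟ i) p≢i)
                          (cong (if_then i else p) (dec-false (p ≟ j) p≢j))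

    inIJ : Fin n → Bool
    inIJ p = does (p ≟ i) ∨ does (p ≟ j)

    between : Fin n → Bool
    between p = does (toℕ i <? toℕ p) ∧ does (toℕ p <? toℕ j)

    rigid : Fin n × Fin n → Bool
    rigid (p , q) = (inIJ p ∧ inIJ q) ∨ ((inIJ p ∧ between q) ∨ (inIJ q ∧ between p))

    rigid-≡ : ∀ p q {a₁ a₂ m₁ m₂} → inIJ p ≡ a₁ → inIJ q ≡ a₂ → between p ≡ m₁ → between q ≡ m₂ →
              rigid (p , q) ≡ (a₁ ∧ a₂) ∨ ((a₁ ∧ m₂) ∨ (a₂ ∧ m₁))
    rigid-≡ p q refl refl refl refl = refl

    inIJ-i : inIJ i ≡ true
    inIJ-i = cong (_∨ does (i ≟ j)) (dec-true (i ≟ i) refl)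

    inIJ-j : inIJ j ≡ true
    inIJ-j = cong₂ _∨_ (dec-false (j ≟ i) (i≢j ∘′ sym)) (dec-true (j ≟ j) refl)

    inIJ-off : ∀ {p} → ¬ p ≡ i → ¬ p ≡ j → inIJ p ≡ false
    inIJ-off {p} p≢i p≢j = cong₂ _∨_ (dec-false (p ≟ i) p≢i) (dec-false (p ≟ j) p≢j)

    between-inside : ∀ {p} → toℕ i < toℕ p → toℕ p < toℕ j → between p ≡ true
    between-inside i<p p<j = cong₂ _∧_ (dec-true (_ <? _) i<p) (dec-true (_ <? _) p<j)

    between-left : ∀ {p} → ¬ toℕ i < toℕ p → between p ≡ false
    between-left {p} i≮p = cong (_∧ does (toℕ p <? toℕ j)) (dec-false (_ <? _) i≮p)

    between-right : ∀ {p} → ¬ toℕ p < toℕ j → between p ≡ false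
    between-right {p} p≮j = trans (cong (does (toℕ i <? toℕ p) ∧_) (dec-false (_ <? _) p≮j)) (∧-zeroʳ _)

    between-i : between i ≡ false
    between-i = between-left (<-irrefl refl)

    between-j : between j ≡ false
    between-j = between-right (<-irrefl refl)

    inIJ-σ : ∀ p → inIJ (σ p) ≡ inIJ p
    inIJ-σ p with place p
    ... | at-i refl = trans (cong inIJ σ-i) (trans inIJ-j (sym inIJ-i))
    ... | at-j refl = trans (cong inIJ σ-j) (trans inIJ-i (sym inIJ-j))
    ... | off p≢i p≢j = cong inIJ (σ-off p≢i p≢j)

    between-σ : ∀ p → between (σ p) ≡ between p
    between-σ p with place p
    ... | at-i refl = trans (cong between σ-i) (trans between-j (sym between-i))
    ... | at-j refl = trans (cong between σ-j) (trans between-i (sym between-j))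
    ... | off p≢i p≢j = cong between (σ-off p≢i p≢j)

    rigid-σ : ∀ p q → rigid (σ p , σ q) ≡ rigid (p , q)
    rigid-σ p q = rigid-≡ (σ p) (σ q) (inIJ-σ p) (inIJ-σ q) (between-σ p) (between-σ q)

    σ² : Fin n × Fin n → Fin n × Fin n
    σ² (p , q) = σ p , σ q

    τ : Fin n × Fin n → Fin n × Fin n
    τ x = if rigid x then x else σ² x

    τ-rigid : ∀ x → rigid x ≡ true → τ x ≡ x
    τ-rigid x r = cong (if_then x else σ² x) r

    τ-flexible : ∀ x → rigid x ≡ false → τ x ≡ σ² x
    τ-flexible x r = cong (if_then x else σ² x) r

    σ-involutive : ∀ p → σ (σ p) ≡ p
    σ-involutive p with place p
    ... | at-i refl = trans (cong σ σ-i) σ-j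
    ... | at-j refl = trans (cong σ σ-j) σ-i
    ... | off p≢i p≢j = trans (cong σ (σ-off p≢i p≢j)) (σ-off p≢i p≢j)

    τ-involutive : ∀ x → τ (τ x) ≡ x
    τ-involutive x = by-rigidity (rigid x) refl
      where
        open ≡-Reasoning
        by-rigidity : ∀ r → rigid x ≡ r → τ (τ x) ≡ x
        by-rigidity true  r = trans (cong τ (τ-rigid x r)) (τ-rigid x r)
        by-rigidity false r = begin
          τ (τ x)                        ≡⟨ cong τ (τ-flexible x r) ⟩
          τ (σ² x)                       ≡⟨ τ-flexible (σ² x) (trans (rigid-σ (proj₁ x) (proj₂ x)) r) ⟩
          σ (σ (proj₁ x)) , σ (σ (proj₂ x)) ≡⟨ cong₂ _,_ (σ-involutive (proj₁ x)) (σ-involutive (proj₂ x)) ⟩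
          x                              ∎

    <-from-≮ : ∀ (p q : Fin n) → ¬ toℕ q < toℕ p → ¬ p ≡ q → toℕ p < toℕ q
    <-from-≮ p q q≮p p≢q = ≤∧≢⇒< (≮⇒≥ q≮p) (λ e → p≢q (toℕ-injective e))

    σ-order : ∀ p q {p′ q′} → σ p ≡ p′ → σ q ≡ q′ → u (σ q) < u (σ p) → u q′ < u p′
    σ-order p q refl refl uσq<uσp = uσq<uσp

    keep : ∀ p q → rigid (p , q) ≡ true → IsInversion u (p , q) → IsInversion u (τ (p , q))
    keep p q r inv = subst (IsInversion u) (sym (τ-rigid (p , q) r)) inv

    relabel : ∀ p q {p′ q′} → rigid (p , q) ≡ false → σ p ≡ p′ → σ q ≡ q′ →
              IsInversion u (p′ , q′) → IsInversion u (τ (p , q))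
    relabel p q r refl refl inv = subst (IsInversion u) (sym (τ-flexible (p , q) r)) inv

    maps-inversions : ∀ p q → toℕ p < toℕ q → u (σ q) < u (σ p) → IsInversion u (τ (p , q))
    maps-inversions p q p<q uσq<uσp with place p | place q
    ... | at-i refl | at-i refl = ⊥-elim (<-irrefl refl p<q)
    ... | at-i refl | at-j refl = ⊥-elim (<-asym uj<ui (σ-order i j σ-i σ-j uσq<uσp))
    ... | at-j refl | at-i refl = ⊥-elim (<-asym i<j p<q)
    ... | at-j refl | at-j refl = ⊥-elim (<-irrefl refl p<q)
    ... | at-i refl | off q≢i q≢j with toℕ q <? toℕ j
    ...   | yes q<j = keep i q (rigid-≡ i q inIJ-i (inIJ-off q≢i q≢j) between-i (between-inside p<q q<j))
                        (p<q , <-trans (σ-order i q σ-i (σ-off q≢i q≢j) uσq<uσp) uj<ui)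
    ...   | no q≮j  = relabel i q (rigid-≡ i q inIJ-i (inIJ-off q≢i q≢j) between-i (between-right q≮j))
                        σ-i (σ-off q≢i q≢j)
                        (<-from-≮ j q q≮j (q≢j ∘′ sym) , σ-order i q σ-i (σ-off q≢i q≢j) uσq<uσp)
    maps-inversions p q p<q uσq<uσp | at-j refl | off q≢i q≢j =
      relabel j q (rigid-≡ j q inIJ-j (inIJ-off q≢i q≢j) between-j (between-right (<-asym p<q)))
        σ-j (σ-off q≢i q≢j)
        (<-trans i<j p<q , σ-order j q σ-j (σ-off q≢i q≢j) uσq<uσp)
    maps-inversions p q p<q uσq<uσp | off p≢i p≢j | at-i refl =
      relabel p i (rigid-≡ p i (inIJ-off p≢i p≢j) inIJ-i (between-left (<-asym p<q)) between-i)
        (σ-off p≢i p≢j) σ-i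
        (<-trans p<q i<j , σ-order p i (σ-off p≢i p≢j) σ-i uσq<uσp)
    maps-inversions p q p<q uσq<uσp | off p≢i p≢j | at-j refl with toℕ i <? toℕ p
    ...   | yes i<p = keep p j (rigid-≡ p j (inIJ-off p≢i p≢j) inIJ-j (between-inside i<p p<q) between-j)
                        (p<q , <-trans uj<ui (σ-order p j (σ-off p≢i p≢j) σ-j uσq<uσp))
    ...   | no i≮p  = relabel p j (rigid-≡ p j (inIJ-off p≢i p≢j) inIJ-j (between-left i≮p) between-j)
                        (σ-off p≢i p≢j) σ-j
                        (<-from-≮ p i i≮p p≢i , σ-order p j (σ-off p≢i p≢j) σ-j uσq<uσp)
    maps-inversions p q p<q uσq<uσp | off p≢i p≢j | off q≢i q≢j =
      relabel p q (rigid-≡ p q (inIJ-off p≢i p≢j) (inIJ-off q≢i q≢j) refl refl)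
        (σ-off p≢i p≢j) (σ-off q≢i q≢j)
        (p<q , σ-order p q (σ-off p≢i p≢j) (σ-off q≢i q≢j) uσq<uσp)

  inversions-swapPos-< : inversions (swapPos i j u) < inversions u
  inversions-swapPos-< = begin-strict
    inversions (swapPos i j u)
      <⟨ length-filter-strictMono (inversion? (swapPos i j u)) (λ x → inversion? u (τ x))
           maps (∈-allPairs (i , j)) ij-kept ij-lost ⟩
    length (filter (λ x → inversion? u (τ x)) (allPairs n))
      ≡⟨ length-filter-involution τ τ-involutive (inversion? u) ⟩
    inversions u ∎
    where
      open ≤-Reasoning
      maps : IsInversion (swapPos i j u) ⊆ (λ x → IsInversion u (τ x))
      maps {p , q} (p<q , wq<wp) =
        maps-inversions p q p<q (subst₂ _<_ (swapPos≡u∘σ q) (swapPos≡u∘σ p) wq<wp)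
      ij-kept : IsInversion u (τ (i , j))
      ij-kept = keep i j (rigid-≡ i j inIJ-i inIJ-j between-i between-j) (i<j , uj<ui)
      ij-lost : ¬ IsInversion (swapPos i j u) (i , j)
      ij-lost (_ , wj<wi) = <-asym uj<ui (σ-order i j σ-i σ-j
        (subst₂ _<_ (swapPos≡u∘σ j) (swapPos≡u∘σ i) wj<wi))

swapPos-self : ∀ {n} (i : Fin n) (u : OneLine n) → swapPos i i u ≗ₒ u
swapPos-self i u p with p ≟ i
... | yes refl = refl
... | no _     = refl

swapPos-comm : ∀ {n} (i j : Fin n) (u : OneLine n) → swapPos i j u ≗ₒ swapPos j i u
swapPos-comm i j u p with p ≟ i | p ≟ j
... | yes refl | yes refl = refl
... | yes refl | no _     = refl
... | no _     | yes refl = refl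
... | no _     | no _     = refl

≗ₒ-swapPos : ∀ {n} {u w : OneLine n} {i j : Fin n} → w i ≡ u j → w j ≡ u i →
             (∀ p → ¬ p ≡ i → ¬ p ≡ j → w p ≡ u p) → w ≗ₒ swapPos i j u
≗ₒ-swapPos {i = i} {j} wi≡uj wj≡ui wp≡up p with p ≟ i
... | yes refl = wi≡uj
... | no p≢i with p ≟ j
...   | yes refl = wj≡ui
...   | no p≢j   = wp≡up p p≢i p≢j

Ascent : ∀ {n} → OneLine n → OneLine n → Set
Ascent {n} u w = Σ (Fin n) λ i → Σ (Fin n) λ j → toℕ i < toℕ j × u i ≤ u j × w ≗ₒ swapPos i j u

descent-swap⇒inversions-< : ∀ {n} {u w : OneLine n} {i j : Fin n} → toℕ i < toℕ j → u j < u i →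
                            w ≗ₒ swapPos i j u → inversions w < inversions u
descent-swap⇒inversions-< {u = u} i<j uj<ui w≗uij =
  subst (_< inversions u) (sym (inversions-resp-≗ₒ w≗uij)) (inversions-swapPos-< u i<j uj<ui)

BruhatStep⇒Ascent : ∀ {n} {u w : OneLine n} → BruhatStep u w → Ascent u w
BruhatStep⇒Ascent {u = u} {w} (i , j , w≗uij , ℓu<ℓw) with <-cmp (toℕ i) (toℕ j)
... | tri< i<j _ _ =
  i , j , i<j , ≮⇒≥ (λ uj<ui → <-asym ℓu<ℓw (descent-swap⇒inversions-< i<j uj<ui w≗uij)) , w≗uij
... | tri> _ _ j<i =
  j , i , j<i , ≮⇒≥ (λ ui<uj → <-asym ℓu<ℓw (descent-swap⇒inversions-< j<i ui<uj w≗uji)) , w≗uji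
  where
    w≗uji : w ≗ₒ swapPos j i u
    w≗uji p = trans (w≗uij p) (swapPos-comm i j u p)
... | tri≈ _ i≡j _ with refl ← toℕ-injective i≡j =
  ⊥-elim (<-irrefl (sym (inversions-resp-≗ₒ λ p → trans (w≗uij p) (swapPos-self i u p))) ℓu<ℓw)

SmallTail : (a b : ℕ) → OneLine (a + b) → Set
SmallTail a b w = ∀ p → b < toℕ p → w p ≤ a

module _ {a b : ℕ} where

  SmallTail-resp-≗ₒ : ∀ {u w} → u ≗ₒ w → SmallTail a b u → SmallTail a b w
  SmallTail-resp-≗ₒ u≗w tail p b<p = subst (_≤ a) (u≗w p) (tail p b<p)

  SmallTail-swapPos : ∀ {u} {i j : Fin (a + b)} → toℕ i < toℕ j → u i ≤ u j →
                      SmallTail a b u → SmallTail a b (swapPos i j u)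
  SmallTail-swapPos {i = i} {j} i<j ui≤uj tail p b<p with p ≟ i
  ... | yes refl = tail j (<-trans b<p i<j)
  ... | no _ with p ≟ j
  ...   | no _ = tail p b<p
  ...   | yes refl with b <? toℕ i
  ...     | yes b<i = tail i b<i
  ...     | no _    = ≤-trans ui≤uj (tail j b<p)

  SmallTail-≤B : ∀ {u w} → u ≤B w → SmallTail a b u → SmallTail a b w
  SmallTail-≤B (≤B-refl u≗w) = SmallTail-resp-≗ₒ u≗w
  SmallTail-≤B (≤B-step step w′≤w) tail with BruhatStep⇒Ascent step
  ... | i , j , i<j , ui≤uj , w′≗uij =
    SmallTail-≤B w′≤w (SmallTail-resp-≗ₒ (λ p → sym (w′≗uij p)) (SmallTail-swapPos i<j ui≤uj tail))

data Region (k b m : ℕ) : Set where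
  before : m < k → Region k b m
  at     : m ≡ k → Region k b m
  middle : k < m → m ≤ b → Region k b m
  after  : b < m → Region k b m

region : ∀ k b m → Region k b m
region k b m with <-cmp m k
... | tri< m<k _ _ = before m<k
... | tri≈ _ m≡k _ = at m≡k
... | tri> _ _ k<m with m ≤? b
...   | yes m≤b = middle k<m m≤b
...   | no m≰b  = after (≰⇒> m≰b)

module _ (a b k : ℕ) (p : Fin (a + b)) where

  vk-before : toℕ p < k → vk a b k p ≡ a + 1 + toℕ p
  vk-before p<k with toℕ p <? k
  ... | yes _  = refl
  ... | no p≮k = ⊥-elim (p≮k p<k)

  vk-at : toℕ p ≡ k → vk a b k p ≡ 1
  vk-at p≡k with toℕ p <? k
  ... | yes p<k = ⊥-elim (<-irrefl p≡k p<k)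
  ... | no _ with toℕ p ℕ.≟ k
  ...   | yes _  = refl
  ...   | no p≢k = ⊥-elim (p≢k p≡k)

  vk-middle : k < toℕ p → toℕ p ≤ b → vk a b k p ≡ a + toℕ p
  vk-middle k<p p≤b with toℕ p <? k
  ... | yes p<k = ⊥-elim (<-asym k<p p<k)
  ... | no _ with toℕ p ℕ.≟ k
  ...   | yes p≡k = ⊥-elim (<-irrefl (sym p≡k) k<p)
  ...   | no _ with toℕ p <? suc b
  ...     | yes _   = refl
  ...     | no p≮1+b = ⊥-elim (p≮1+b (s≤s p≤b))

  vk-after : k ≤ b → b < toℕ p → vk a b k p ≡ toℕ p ∸ b + 1
  vk-after k≤b b<p with toℕ p <? k
  ... | yes p<k = ⊥-elim (<-asym b<p (<-≤-trans p<k k≤b))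
  ... | no _ with toℕ p ℕ.≟ k
  ...   | yes p≡k = ⊥-elim (<-irrefl refl (<-≤-trans b<p (subst (_≤ b) (sym p≡k) k≤b)))
  ...   | no _ with toℕ p <? suc b
  ...     | yes p<1+b = ⊥-elim (<-irrefl refl (<-≤-trans b<p (s≤s⁻¹ p<1+b)))
  ...     | no _      = refl

module _ (a b k : ℕ) (0<a : 0 < a) (k≤b : k ≤ b) where

  private
    v : OneLine (a + b)
    v = vk a b k

    after-value≤a : ∀ m → b < m → m < a + b → m ∸ b + 1 ≤ a
    after-value≤a m b<m m<n = subst (_≤ a) (sym (+-comm (m ∸ b) 1))
      (subst (m ∸ b <_) (m+n∸n≡m a b) (∸-monoˡ-< m<n (<⇒≤ b<m)))

    2≤after-value : ∀ m → b < m → 2 ≤ m ∸ b + 1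
    2≤after-value m b<m = subst (2 ≤_) (sym (+-comm (m ∸ b) 1)) (s≤s (m<n⇒0<n∸m b<m))

    large-before : ∀ p → toℕ p < k → a < v p
    large-before p p<k rewrite vk-before a b k p p<k | +-assoc a 1 (toℕ p) = m<m+n a (s≤s z≤n)

    large-middle : ∀ p → k < toℕ p → toℕ p ≤ b → a < v p
    large-middle p k<p p≤b rewrite vk-middle a b k p k<p p≤b = m<m+n a (≤-<-trans z≤n k<p)

    vk-bounds : ∀ p → 1 ≤ v p × v p ≤ a + b
    vk-bounds p with region k b (toℕ p)
    ... | before p<k rewrite vk-before a b k p p<k | +-assoc a 1 (toℕ p) =
          ≤-trans 0<a (m≤m+n a _) , +-monoʳ-≤ a (≤-trans p<k k≤b)
    ... | at p≡k rewrite vk-at a b k p p≡k = ≤-refl , ≤-trans 0<a (m≤m+n a b)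
    ... | middle k<p p≤b rewrite vk-middle a b k p k<p p≤b = ≤-trans 0<a (m≤m+n a _) , +-monoʳ-≤ a p≤b
    ... | after b<p rewrite vk-after a b k p k≤b b<p =
          ≤-trans (s≤s z≤n) (2≤after-value (toℕ p) b<p) ,
          ≤-trans (after-value≤a (toℕ p) b<p (toℕ<n p)) (m≤m+n a b)

    ¬2≤1 : ¬ (2 ≤ 1)
    ¬2≤1 (s≤s ())

    position : ℕ → ℕ
    position y with y ℕ.≟ 1
    ... | yes _ = k
    ... | no _ with y ≤? a
    ...   | yes _ = y + b ∸ 1
    ...   | no _ with y ≤? a + k
    ...     | yes _ = y ∸ a ∸ 1
    ...     | no _  = y ∸ a

    position-small : ∀ y → 1 < y → y ≤ a → position y ≡ y + b ∸ 1
    position-small y 1<y y≤a with y ℕ.≟ 1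
    ... | yes y≡1 = ⊥-elim (<-irrefl (sym y≡1) 1<y)
    ... | no _ with y ≤? a
    ...   | yes _  = refl
    ...   | no y≰a = ⊥-elim (y≰a y≤a)

    position-low : ∀ y → a < y → y ≤ a + k → position y ≡ y ∸ a ∸ 1
    position-low y a<y y≤a+k with y ℕ.≟ 1
    ... | yes y≡1 = ⊥-elim (¬2≤1 (≤-trans (s≤s 0<a) (≤-trans a<y (≤-reflexive y≡1))))
    ... | no _ with y ≤? a
    ...   | yes y≤a = ⊥-elim (<-irrefl refl (<-≤-trans a<y y≤a))
    ...   | no _ with y ≤? a + k
    ...     | yes _    = refl
    ...     | no y≰a+k = ⊥-elim (y≰a+k y≤a+k)

    position-high : ∀ y → a + k < y → position y ≡ y ∸ a
    position-high y a+k<y with y ℕ.≟ 1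
    ... | yes y≡1 = ⊥-elim (¬2≤1 (≤-trans (s≤s 0<a) (≤-trans (≤-<-trans (m≤m+n a k) a+k<y) (≤-reflexive y≡1))))
    ... | no _ with y ≤? a
    ...   | yes y≤a = ⊥-elim (<-irrefl refl (<-≤-trans (≤-<-trans (m≤m+n a k) a+k<y) y≤a))
    ...   | no _ with y ≤? a + k
    ...     | yes y≤a+k = ⊥-elim (<-irrefl refl (<-≤-trans a+k<y y≤a+k))
    ...     | no _      = refl

    position-vk : ∀ p → position (v p) ≡ toℕ p
    position-vk p with region k b (toℕ p)
    ... | before p<k rewrite vk-before a b k p p<k =
          trans (position-low (a + 1 + toℕ p) a<v v≤a+k)
                (cong (_∸ 1) (trans (cong (_∸ a) (+-assoc a 1 (toℕ p))) (m+n∸m≡n a (1 + toℕ p))))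
      where a<v : a < a + 1 + toℕ p
            a<v = subst (a <_) (sym (+-assoc a 1 (toℕ p))) (m<m+n a (s≤s z≤n))
            v≤a+k : a + 1 + toℕ p ≤ a + k
            v≤a+k = subst (_≤ a + k) (sym (+-assoc a 1 (toℕ p))) (+-monoʳ-≤ a p<k)
    ... | at p≡k rewrite vk-at a b k p p≡k = sym p≡k
    ... | middle k<p p≤b rewrite vk-middle a b k p k<p p≤b =
          trans (position-high (a + toℕ p) (+-monoʳ-< a k<p)) (m+n∸m≡n a (toℕ p))
    ... | after b<p rewrite vk-after a b k p k≤b b<p =
          trans (position-small (toℕ p ∸ b + 1) (2≤after-value (toℕ p) b<p)
                  (after-value≤a (toℕ p) b<p (toℕ<n p)))
                (cong (_∸ 1) (trans (cong (_+ b) (+-comm (toℕ p ∸ b) 1)) (cong suc (m∸n+n≡m (<⇒≤ b<p)))))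

  vk-SmallTail : SmallTail a b (vk a b k)
  vk-SmallTail p b<p rewrite vk-after a b k p k≤b b<p = after-value≤a (toℕ p) b<p (toℕ<n p)

  vk-InS : InS (a + b) (vk a b k)
  vk-InS = vk-bounds , λ p q vp≡vq →
    toℕ-injective (trans (sym (position-vk p)) (trans (cong position vp≡vq) (position-vk q)))

  vk-InLeftParabolic : InLeftParabolic a b (vk a b k)
  vk-InLeftParabolic = small-ordered , large-ordered
    where
      v≥1 : ∀ p → 1 ≤ v p
      v≥1 p = proj₁ (vk-bounds p)

      small-ordered : ∀ p q → v p < v q → v q ≤ a → toℕ p < toℕ q
      small-ordered p q vp<vq vq≤a with region k b (toℕ q)
      ... | before q<k       = ⊥-elim (<-irrefl refl (<-≤-trans (large-before q q<k) vq≤a))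
      ... | middle k<q q≤b   = ⊥-elim (<-irrefl refl (<-≤-trans (large-middle q k<q q≤b) vq≤a))
      ... | at q≡k           = ⊥-elim (<-irrefl refl (<-≤-trans vp<vq (≤-trans (≤-reflexive (vk-at a b k q q≡k)) (v≥1 p))))
      ... | after b<q with region k b (toℕ p)
      ...   | before p<k     = ⊥-elim (<-asym vp<vq (≤-<-trans vq≤a (large-before p p<k)))
      ...   | middle k<p p≤b = ⊥-elim (<-asym vp<vq (≤-<-trans vq≤a (large-middle p k<p p≤b)))
      ...   | at p≡k         = subst (_< toℕ q) (sym p≡k) (≤-<-trans k≤b b<q)
      ...   | after b<p      = subst₂ _<_ (m∸n+n≡m (<⇒≤ b<p)) (m∸n+n≡m (<⇒≤ b<q))
          (+-monoˡ-< b (+-cancelʳ-< 1 _ _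
            (subst₂ _<_ (vk-after a b k p k≤b b<p) (vk-after a b k q k≤b b<q) vp<vq)))

      large-ordered : ∀ p q → a < v p → v p < v q → toℕ p < toℕ q
      large-ordered p q a<vp vp<vq with region k b (toℕ p)
      ... | at p≡k    = ⊥-elim (<-irrefl refl (≤-<-trans 0<a (<-≤-trans a<vp (≤-reflexive (vk-at a b k p p≡k)))))
      ... | after b<p = ⊥-elim (<-irrefl refl (<-≤-trans a<vp (vk-SmallTail p b<p)))
      ... | before p<k with region k b (toℕ q)
      ...   | at q≡k       = ⊥-elim (<-irrefl refl (<-≤-trans vp<vq (≤-trans (≤-reflexive (vk-at a b k q q≡k)) (v≥1 p))))
      ...   | after b<q    = ⊥-elim (<-asym a<vp (<-≤-trans vp<vq (vk-SmallTail q b<q)))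
      ...   | middle k<q _ = <-trans p<k k<q
      ...   | before q<k   = +-cancelˡ-< (a + 1) _ _
          (subst₂ _<_ (vk-before a b k p p<k) (vk-before a b k q q<k) vp<vq)
      large-ordered p q a<vp vp<vq | middle k<p p≤b with region k b (toℕ q)
      ...   | at q≡k         = ⊥-elim (<-irrefl refl (<-≤-trans vp<vq (≤-trans (≤-reflexive (vk-at a b k q q≡k)) (v≥1 p))))
      ...   | after b<q      = ⊥-elim (<-asym a<vp (<-≤-trans vp<vq (vk-SmallTail q b<q)))
      ...   | middle k<q q≤b = +-cancelˡ-< a _ _
          (subst₂ _<_ (vk-middle a b k p k<p p≤b) (vk-middle a b k q k<q q≤b) vp<vq)
      ...   | before q<k     = ⊥-elim (<-asym vp<vq (begin-strict
          v q               ≡⟨ vk-before a b k q q<k ⟩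
          a + 1 + toℕ q     ≡⟨ +-assoc a 1 (toℕ q) ⟩
          a + suc (toℕ q)   <⟨ +-monoʳ-< a (≤-<-trans q<k k<p) ⟩
          a + toℕ p         ≡⟨ sym (vk-middle a b k p k<p p≤b) ⟩
          v p               ∎))
        where open ≤-Reasoning

module _ (a b : ℕ) (0<a : 0 < a) where

  private
    b<a+b : b < a + b
    b<a+b = m<n+m b 0<a

  module _ {k : ℕ} (k<b : k < b) where

    private
      i j : Fin (a + b)
      i = fromℕ< (<-trans k<b b<a+b)
      j = fromℕ< (≤-<-trans k<b b<a+b)

      toℕ-i : toℕ i ≡ k
      toℕ-i = toℕ-fromℕ< _

      toℕ-j : toℕ j ≡ suc k
      toℕ-j = toℕ-fromℕ< _

      i<j : toℕ i < toℕ j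
      i<j = subst₂ _<_ (sym toℕ-i) (sym toℕ-j) (n<1+n k)

      vk-i : vk a b k i ≡ 1
      vk-i = vk-at a b k i toℕ-i

      vk-j : vk a b k j ≡ a + suc k
      vk-j = trans (vk-middle a b k j (subst (k <_) (sym toℕ-j) (n<1+n k)) (≤-trans (≤-reflexive toℕ-j) k<b))
                   (cong (a +_) toℕ-j)

      vk-suc-i : vk a b (suc k) i ≡ a + suc k
      vk-suc-i = trans (vk-before a b (suc k) i (subst (_< suc k) (sym toℕ-i) (n<1+n k)))
                       (trans (cong (a + 1 +_) toℕ-i) (+-assoc a 1 k))

      vk-suc-j : vk a b (suc k) j ≡ 1
      vk-suc-j = vk-at a b (suc k) j toℕ-j

      vk-off : ∀ p → ¬ p ≡ i → ¬ p ≡ j → vk a b k p ≡ vk a b (suc k) p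
      vk-off p p≢i p≢j with region (suc k) b (toℕ p)
      ... | before p<1+k = trans (vk-before a b k p p<k) (sym (vk-before a b (suc k) p p<1+k))
        where
          p<k : toℕ p < k
          p<k = ≤∧≢⇒< (s≤s⁻¹ p<1+k) (λ p≡k → p≢i (toℕ-injective (trans p≡k (sym toℕ-i))))
      ... | at p≡1+k = ⊥-elim (p≢j (toℕ-injective (trans p≡1+k (sym toℕ-j))))
      ... | middle 1+k<p p≤b =
            trans (vk-middle a b k p (<-trans (n<1+n k) 1+k<p) p≤b) (sym (vk-middle a b (suc k) p 1+k<p p≤b))
      ... | after b<p = trans (vk-after a b k p (<⇒≤ k<b) b<p) (sym (vk-after a b (suc k) p k<b b<p))

      vk-suc≗swapPos : vk a b (suc k) ≗ₒ swapPos i j (vk a b k)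
      vk-suc≗swapPos = ≗ₒ-swapPos (trans vk-suc-i (sym vk-j)) (trans vk-suc-j (sym vk-i))
                         (λ p p≢i p≢j → sym (vk-off p p≢i p≢j))

      vk≗swapPos : vk a b k ≗ₒ swapPos i j (vk a b (suc k))
      vk≗swapPos = ≗ₒ-swapPos (trans vk-i (sym vk-suc-j)) (trans vk-j (sym vk-suc-i)) vk-off

    inversions-vk-< : inversions (vk a b k) < inversions (vk a b (suc k))
    inversions-vk-< = descent-swap⇒inversions-< i<j
      (subst₂ _<_ (sym vk-suc-j) (sym vk-suc-i) (≤-trans (s≤s 0<a) (subst (suc a ≤_) (sym (+-suc a k)) (s≤s (m≤m+n a k)))))
      vk≗swapPos

    vk-BruhatStep : BruhatStep (vk a b k) (vk a b (suc k))
    vk-BruhatStep = i , j , vk-suc≗swapPos , inversions-vk-<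

  vk-≤B-vk-+ : ∀ k d → k + d ≤ b → vk a b k ≤B vk a b (k + d)
  vk-≤B-vk-+ k zero    _         = ≤B-refl (λ p → cong (λ m → vk a b m p) (sym (+-identityʳ k)))
  vk-≤B-vk-+ k (suc d) k+[1+d]≤b = ≤B-step (vk-BruhatStep k<b)
      (subst (λ m → vk a b (suc k) ≤B vk a b m) (sym (+-suc k d)) (vk-≤B-vk-+ (suc k) d 1+k+d≤b))
    where
      1+k+d≤b : suc k + d ≤ b
      1+k+d≤b = subst (_≤ b) (+-suc k d) k+[1+d]≤b
      k<b : k < b
      k<b = ≤-trans (s≤s (m≤m+n k d)) 1+k+d≤b

  vk-≤B-vk⇔≤ : ∀ {k j} → k ≤ b → j ≤ b → (vk a b k ≤B vk a b j) ⇔ (k ≤ j)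
  vk-≤B-vk⇔≤ {k} {j} k≤b j≤b = mk⇔ to from
    where
      to : vk a b k ≤B vk a b j → k ≤ j
      to vk≤vj = ≮⇒≥ λ j<k → <⇒≱
        (stepwise-strictMono (λ t → inversions (vk a b t)) (λ t → inversions-vk-< {t}) j<k k≤b)
        (≤B⇒inversions-≤ vk≤vj)
      from : k ≤ j → vk a b k ≤B vk a b j
      from k≤j = subst (λ m → vk a b k ≤B vk a b m) (m+[n∸m]≡n k≤j)
        (vk-≤B-vk-+ k (j ∸ k) (subst (_≤ b) (sym (m+[n∸m]≡n k≤j)) j≤b))

module _ {a b : ℕ} {v : OneLine (a + b)} (v∈S : InS (a + b) v) (v∈ᴸS : InLeftParabolic a b v) where

  small-entries-increasing : ∀ {p q} → toℕ p < toℕ q → v p ≤ a → v q ≤ a → v p < v q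
  small-entries-increasing {p} {q} p<q vp≤a vq≤a with <-cmp (v p) (v q)
  ... | tri< vp<vq _ _ = vp<vq
  ... | tri≈ _ vp≡vq _ = ⊥-elim (<-irrefl (cong toℕ (proj₂ v∈S p q vp≡vq)) p<q)
  ... | tri> _ _ vq<vp = ⊥-elim (<-asym p<q (proj₁ v∈ᴸS q p vq<vp vp≤a))

  large-entries-increasing : ∀ {p q} → toℕ p < toℕ q → a < v p → a < v q → v p < v q
  large-entries-increasing {p} {q} p<q a<vp a<vq with <-cmp (v p) (v q)
  ... | tri< vp<vq _ _ = vp<vq
  ... | tri≈ _ vp≡vq _ = ⊥-elim (<-irrefl (cong toℕ (proj₂ v∈S p q vp≡vq)) p<q)
  ... | tri> _ _ vq<vp = ⊥-elim (<-asym p<q (proj₂ v∈ᴸS q p a<vq vq<vp))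

module Classification (a₀ b₀ : ℕ) where

  private
    a b : ℕ
    a = suc a₀
    b = suc b₀

  module _ {v : OneLine (a + b)} (v∈S : InS (a + b) v) (v∈ᴸS : InLeftParabolic a b v)
           (tail : SmallTail a b v) where

    private
      b<a+b : b < a + b
      b<a+b = m<n+m b (s≤s z≤n)

      -- the junk value 0 beyond position a + b is never used
      V : ℕ → ℕ
      V m with m <? a + b
      ... | yes m<n = v (fromℕ< m<n)
      ... | no _    = 0

      V-fromℕ< : ∀ {m} (m<n : m < a + b) → V m ≡ v (fromℕ< m<n)
      V-fromℕ< {m} m<n with m <? a + b
      ... | yes _  = refl
      ... | no m≮n = ⊥-elim (m≮n m<n)

      V-toℕ : ∀ p → V (toℕ p) ≡ v p
      V-toℕ p = trans (V-fromℕ< (toℕ<n p)) (cong v (fromℕ<-toℕ p (toℕ<n p)))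

      V-positive : ∀ {m} → m < a + b → 1 ≤ V m
      V-positive m<n = subst (1 ≤_) (sym (V-fromℕ< m<n)) (proj₁ (proj₁ v∈S (fromℕ< m<n)))

      V-≤ : ∀ {m} → m < a + b → V m ≤ a + b
      V-≤ m<n = subst (_≤ a + b) (sym (V-fromℕ< m<n)) (proj₂ (proj₁ v∈S (fromℕ< m<n)))

      V-injective : ∀ {x y} → x < a + b → y < a + b → V x ≡ V y → x ≡ y
      V-injective {x} {y} x<n y<n Vx≡Vy = begin
        x                      ≡⟨ sym (toℕ-fromℕ< x<n) ⟩
        toℕ (fromℕ< x<n)       ≡⟨ cong toℕ (proj₂ v∈S _ _ (trans (sym (V-fromℕ< x<n)) (trans Vx≡Vy (V-fromℕ< y<n)))) ⟩
        toℕ (fromℕ< y<n)       ≡⟨ toℕ-fromℕ< y<n ⟩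
        y                      ∎
        where open ≡-Reasoning

      V-tail : ∀ {m} → b < m → m < a + b → V m ≤ a
      V-tail {m} b<m m<n = subst (_≤ a) (sym (V-fromℕ< m<n)) (tail (fromℕ< m<n) (subst (b <_) (sym (toℕ-fromℕ< m<n)) b<m))

      V-small-increasing : ∀ {x y} → x < y → y < a + b → V x ≤ a → V y ≤ a → V x < V y
      V-small-increasing {x} {y} x<y y<n Vx≤a Vy≤a =
        subst₂ _<_ (sym (V-fromℕ< x<n)) (sym (V-fromℕ< y<n))
          (small-entries-increasing v∈S v∈ᴸS (subst₂ _<_ (sym (toℕ-fromℕ< x<n)) (sym (toℕ-fromℕ< y<n)) x<y)
            (subst (_≤ a) (V-fromℕ< x<n) Vx≤a) (subst (_≤ a) (V-fromℕ< y<n) Vy≤a))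
        where
          x<n : x < a + b
          x<n = <-trans x<y y<n

      V-large-increasing : ∀ {x y} → x < y → y < a + b → a < V x → a < V y → V x < V y
      V-large-increasing {x} {y} x<y y<n a<Vx a<Vy =
        subst₂ _<_ (sym (V-fromℕ< x<n)) (sym (V-fromℕ< y<n))
          (large-entries-increasing v∈S v∈ᴸS (subst₂ _<_ (sym (toℕ-fromℕ< x<n)) (sym (toℕ-fromℕ< y<n)) x<y)
            (subst (a <_) (V-fromℕ< x<n) a<Vx) (subst (a <_) (V-fromℕ< y<n) a<Vy))
        where
          x<n : x < a + b
          x<n = <-trans x<y y<n

      -- If position m ≤ b holds a small value, so do the a positions m, b+1, …, a+b−1;
      -- being increasing and ≥ 1, these values are exactly 1, 2, …, a.
      small-positions : ℕ → ℕ → ℕ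
      small-positions m zero    = m
      small-positions m (suc t) = b + suc t

      module _ {m : ℕ} (m≤b : m ≤ b) (Vm≤a : V m ≤ a) where

        small-positions-< : ∀ t → t ≤ a₀ → small-positions m t < a + b
        small-positions-< zero    _      = ≤-<-trans m≤b b<a+b
        small-positions-< (suc t) 1+t≤a₀ = subst (b + suc t <_) (+-comm b a) (+-monoʳ-< b (s≤s 1+t≤a₀))

        small-positions-small : ∀ t → t ≤ a₀ → V (small-positions m t) ≤ a
        small-positions-small zero    _      = Vm≤a
        small-positions-small (suc t) 1+t≤a₀ = V-tail (m<m+n b (s≤s z≤n)) (small-positions-< (suc t) 1+t≤a₀)

        small-positions-increasing : ∀ t → small-positions m t < small-positions m (suc t)
        small-positions-increasing zero    = ≤-<-trans m≤b (m<m+n b (s≤s z≤n))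
        small-positions-increasing (suc t) = +-monoʳ-< b (n<1+n (suc t))

        small-values : ∀ t → t ≤ a₀ → V (small-positions m t) ≡ suc t
        small-values = stepwise-squeeze (λ t → V (small-positions m t)) step
                         (V-positive (small-positions-< 0 z≤n)) (small-positions-small a₀ ≤-refl)
          where
            step : ∀ t → suc t ≤ a₀ → V (small-positions m t) < V (small-positions m (suc t))
            step t 1+t≤a₀ = V-small-increasing (small-positions-increasing t) (small-positions-< (suc t) 1+t≤a₀)
              (small-positions-small t (≤-trans (n≤1+n t) 1+t≤a₀)) (small-positions-small (suc t) 1+t≤a₀)

      small-in-head : Σ ℕ λ k → k ≤ b × V k ≤ a
      small-in-head with any? (λ (t : Fin (suc b)) → V (toℕ t) ≤? a)
      ... | yes (t , Vt≤a) = toℕ t , s≤s⁻¹ (toℕ<n t) , Vt≤a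
      ... | no ¬small      = ⊥-elim (<-irrefl refl (begin-strict
          a + b        <⟨ +-monoˡ-< b (large z≤n) ⟩
          V 0 + b      ≤⟨ stepwise-+-≤ V step 0 b ≤-refl ⟩
          V b          ≤⟨ V-≤ b<a+b ⟩
          a + b        ∎))
        where
          open ≤-Reasoning
          large : ∀ {m} → m ≤ b → a < V m
          large {m} m≤b = ≰⇒> λ Vm≤a →
            ¬small (fromℕ< (s≤s m≤b) , subst (λ x → V x ≤ a) (sym (toℕ-fromℕ< (s≤s m≤b))) Vm≤a)
          step : ∀ t → suc t ≤ b → V t < V (suc t)
          step t 1+t≤b = V-large-increasing (n<1+n t) (≤-<-trans 1+t≤b b<a+b)
                           (large (≤-trans (n≤1+n t) 1+t≤b)) (large 1+t≤b)

      module _ {k : ℕ} (k≤b : k ≤ b) (Vk≤a : V k ≤ a) where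

        Vk≡1 : V k ≡ 1
        Vk≡1 = small-values k≤b Vk≤a 0 z≤n

        V-tail-value : ∀ t → suc t ≤ a₀ → V (b + suc t) ≡ suc (suc t)
        V-tail-value t = small-values k≤b Vk≤a (suc t)

        large-off-k : ∀ {m} → m ≤ b → ¬ m ≡ k → a < V m
        large-off-k m≤b m≢k = ≰⇒> λ Vm≤a → m≢k (V-injective (≤-<-trans m≤b b<a+b) (≤-<-trans k≤b b<a+b)
                                 (trans (small-values m≤b Vm≤a 0 z≤n) (sym Vk≡1)))

        large-positions : ℕ → ℕ
        large-positions t with t <? k
        ... | yes _ = t
        ... | no _  = suc t

        large-positions-< : ∀ {t} → t < k → large-positions t ≡ t
        large-positions-< {t} t<k with t <? k
        ... | yes _  = refl
        ... | no t≮k = ⊥-elim (t≮k t<k)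

        large-positions-≥ : ∀ {t} → k ≤ t → large-positions t ≡ suc t
        large-positions-≥ {t} k≤t with t <? k
        ... | yes t<k = ⊥-elim (<⇒≱ t<k k≤t)
        ... | no _    = refl

        large-positions-increasing : ∀ t → large-positions t < large-positions (suc t)
        large-positions-increasing t with t <? k | suc t <? k
        ... | yes _   | yes _    = n<1+n t
        ... | yes _   | no _     = <-trans (n<1+n t) (n<1+n (suc t))
        ... | no t≮k  | yes 1+t<k = ⊥-elim (t≮k (<-trans (n<1+n t) 1+t<k))
        ... | no _    | no _     = n<1+n (suc t)

        large-positions-≢k : ∀ t → ¬ large-positions t ≡ k
        large-positions-≢k t with t <? k
        ... | yes t<k = λ t≡k → <-irrefl t≡k t<k
        ... | no t≮k  = λ 1+t≡k → t≮k (subst (t <_) 1+t≡k (n<1+n t))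

        large-positions-≤ : ∀ {t} → t ≤ b₀ → large-positions t ≤ b
        large-positions-≤ {t} t≤b₀ with t <? k
        ... | yes _ = m≤n⇒m≤1+n t≤b₀
        ... | no _  = s≤s t≤b₀

        large-values : ∀ t → t ≤ b₀ → V (large-positions t) ≡ suc a + t
        large-values = stepwise-squeeze (λ t → V (large-positions t)) step
            (large 0 z≤n) (subst (V (large-positions b₀) ≤_) (+-suc a b₀) (V-≤ (position<n ≤-refl)))
          where
            position<n : ∀ {t} → t ≤ b₀ → large-positions t < a + b
            position<n t≤b₀ = ≤-<-trans (large-positions-≤ t≤b₀) b<a+b
            large : ∀ t → t ≤ b₀ → a < V (large-positions t)
            large t t≤b₀ = large-off-k (large-positions-≤ t≤b₀) (large-positions-≢k t)
            step : ∀ t → suc t ≤ b₀ → V (large-positions t) < V (large-positions (suc t))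
            step t 1+t≤b₀ = V-large-increasing (large-positions-increasing t) (position<n 1+t≤b₀)
                              (large t (≤-trans (n≤1+n t) 1+t≤b₀)) (large (suc t) 1+t≤b₀)

        V-before : ∀ {m} → m < k → V m ≡ a + 1 + m
        V-before {m} m<k = begin
          V m                    ≡⟨ cong V (sym (large-positions-< m<k)) ⟩
          V (large-positions m)  ≡⟨ large-values m (s≤s⁻¹ (<-≤-trans m<k k≤b)) ⟩
          suc a + m              ≡⟨ cong (_+ m) (+-comm 1 a) ⟩
          a + 1 + m              ∎
          where open ≡-Reasoning

        V-middle : ∀ {m} → k < m → m ≤ b → V m ≡ a + m
        V-middle {suc t} k<1+t 1+t≤b = begin
          V (suc t)              ≡⟨ cong V (sym (large-positions-≥ (s≤s⁻¹ k<1+t))) ⟩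
          V (large-positions t)  ≡⟨ large-values t (s≤s⁻¹ 1+t≤b) ⟩
          suc a + t              ≡⟨ sym (+-suc a t) ⟩
          a + suc t              ∎
          where open ≡-Reasoning

        V-after : ∀ {m} → b < m → m < a + b → V m ≡ m ∸ b + 1
        V-after {m} b<m m<n = begin
          V m                  ≡⟨ cong V (sym b+[1+t]≡m) ⟩
          V (b + suc t)        ≡⟨ V-tail-value t 1+t≤a₀ ⟩
          suc (suc t)          ≡⟨ +-comm 1 (suc t) ⟩
          suc t + 1            ≡⟨ cong (_+ 1) (sym (m+n∸m≡n b (suc t))) ⟩
          b + suc t ∸ b + 1    ≡⟨ cong (λ x → x ∸ b + 1) b+[1+t]≡m ⟩
          m ∸ b + 1            ∎
          where
            open ≡-Reasoning
            t : ℕ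
            t = m ∸ suc b
            b+[1+t]≡m : b + suc t ≡ m
            b+[1+t]≡m = trans (+-suc b t) (m+[n∸m]≡n b<m)
            1+t≤a₀ : suc t ≤ a₀
            1+t≤a₀ = s≤s⁻¹ (+-cancelˡ-< b (suc t) a (subst₂ _<_ (sym b+[1+t]≡m) (+-comm a b) m<n))

        v≗vk : v ≗ₒ vk a b k
        v≗vk p = trans (sym (V-toℕ p)) (by-region (region k b (toℕ p)))
          where
            by-region : Region k b (toℕ p) → V (toℕ p) ≡ vk a b k p
            by-region (before p<k)     = trans (V-before p<k) (sym (vk-before a b k p p<k))
            by-region (at p≡k)         = trans (cong V p≡k) (trans Vk≡1 (sym (vk-at a b k p p≡k)))
            by-region (middle k<p p≤b) = trans (V-middle k<p p≤b) (sym (vk-middle a b k p k<p p≤b))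
            by-region (after b<p)      = trans (V-after b<p (toℕ<n p)) (sym (vk-after a b k p k≤b b<p))

    classification : Σ ℕ λ k → k ≤ b × v ≗ₒ vk a b k
    classification with small-in-head
    ... | k , k≤b , Vk≤a = k , k≤b , v≗vk k≤b Vk≤a

SmallTail-classification : ∀ {a b} → 0 < a → 0 < b → ∀ {v} → InS (a + b) v → InLeftParabolic a b v →
                           SmallTail a b v → Σ ℕ λ k → k ≤ b × v ≗ₒ vk a b k
SmallTail-classification {suc a₀} {suc b₀} _ _ = Classification.classification a₀ b₀

lemma4p3 : (a b : ℕ) → 0 < a → 0 < b →
    ((∀ k → k ≤ b → InS (a + b) (vk a b k) × InLeftParabolic a b (vk a b k) × (vk a b 0 ≤B vk a b k))
      × (∀ v → InS (a + b) v → InLeftParabolic a b v → vk a b 0 ≤B v →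
           Σ ℕ (λ k → k ≤ b × (v ≗ₒ vk a b k))))
    × (∀ k j → k ≤ b → j ≤ b → (vk a b k ≤B vk a b j) ⇔ (k ≤ j))
lemma4p3 a b 0<a 0<b = (vk-properties , above-v₀-is-vk) , λ k j → vk-≤B-vk⇔≤ a b 0<a
  where
    vk-properties : ∀ k → k ≤ b →
      InS (a + b) (vk a b k) × InLeftParabolic a b (vk a b k) × (vk a b 0 ≤B vk a b k)
    vk-properties k k≤b = vk-InS a b k 0<a k≤b , vk-InLeftParabolic a b k 0<a k≤b ,
                          Equivalence.from (vk-≤B-vk⇔≤ a b 0<a z≤n k≤b) z≤n

    above-v₀-is-vk : ∀ v → InS (a + b) v → InLeftParabolic a b v → vk a b 0 ≤B v →
                     Σ ℕ (λ k → k ≤ b × (v ≗ₒ vk a b k))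
    above-v₀-is-vk v v∈S v∈ᴸS v₀≤v = SmallTail-classification 0<a 0<b v∈S v∈ᴸS
      (SmallTail-≤B v₀≤v (vk-SmallTail a b 0 0<a z≤n))
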